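{- Let $d=3k$ for a positive integer $k$. If $\varphi$ is a partial $d$-edge coloring of $Q_d$ in which all colored edges are contained in a matching, then $\varphi$ is avoidable.
   Context: $Q_d$ is the $d$-dimensional hypercube. A partial $d$-edge coloring assigns colors from $\{1,\dots,d\}$ to some subset of edges; it is avoidable if there is a proper $d$-edge coloring $f$ of $Q_d$ with colors $1,\dots,d$ such that $f(e)\neq\varphi(e)$ for every colored edge $e$. -}

module Defs where

open import Data.Nat using (ℕ)
open import Data.Bool using (Bool; not)
open import Data.Fin using (Fin)
open import Data.Vec using (Vec; updateAt)
open import Data.Maybe using (Maybe; just)
open import Data.Product using (Σ; _×_; _,_; proj₁)
open import Relation.Binary.PropositionalEquality using (_≡_; _≢_)
open import Function.Definitions using (Injective)

Vertex : ℕ → Set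
Vertex d = Vec Bool d

flipAt : ∀ {d} → Vertex d → Fin d → Vertex d
flipAt v i = updateAt v i not

-- Every edge of Q_d is {v , flipAt v i}; it is described (twice) by the
-- pairs (v , i) and (flipAt v i , i).  A labelling of edges is thus a
-- function on such pairs that agrees on both descriptions of each edge.
IsEdgeLabelling : ∀ {d} {A : Set} → (Vertex d → Fin d → A) → Set
IsEdgeLabelling {d} g = ∀ (v : Vertex d) (i : Fin d) → g (flipAt v i) i ≡ g v i

EdgeColoring : ℕ → Set
EdgeColoring d = Σ (Vertex d → Fin d → Fin d) IsEdgeLabelling

PartialColoring : ℕ → Set
PartialColoring d = Σ (Vertex d → Fin d → Maybe (Fin d)) IsEdgeLabelling

IsProper : ∀ {d} → EdgeColoring d → Set
IsProper {d} (f , _) = ∀ (v : Vertex d) → Injective _≡_ _≡_ (f v)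

ColoredEdgesFormMatching : ∀ {d} → PartialColoring d → Set
ColoredEdgesFormMatching {d} (φ , _) =
  ∀ (v : Vertex d) (i j : Fin d) (a b : Fin d) →
    φ v i ≡ just a → φ v j ≡ just b → i ≡ j

IsAvoidable : ∀ {d} → PartialColoring d → Set
IsAvoidable {d} (φ , _) =
  Σ (EdgeColoring d) λ F → IsProper F ×
    (∀ (v : Vertex d) (i : Fin d) (c : Fin d) →
       φ v i ≡ just c → proj₁ F v i ≢ c)

module Submission where

-- Split the 3k coordinates of Q₃ₖ, and likewise the 3k colours, into k blocks of three.
-- Fixing all coordinates outside block b leaves a copy of Q₃; the colours of φ that lie
-- in colour block b restrict to a matching colouring of that copy, which is avoided by
-- a proper 3-colouring with colours from block b.  These local colourings glue to a
-- proper colouring of Q₃ₖ, because an edge in coordinate block b receives a colour of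
-- block b.  For Q₃ itself, every matching colouring is avoided by a colouring that uses
-- one permutation of the colours on each of the two layers {v | vₜ = 0} and {v | vₜ = 1}
-- of some direction t; this finite claim is checked by an exhaustive search.

open import Defs
open import Data.Nat using (ℕ; zero; suc; _*_; _<_)
open import Data.Bool using (Bool; true; false; not; if_then_else_; T) renaming (_≟_ to _≟ᵇ_)
open import Data.Bool.Properties using (¬-not; T-≡)
open import Data.Bool.ListAction using (all)
open import Data.Fin using (Fin; zero; suc; combine; remQuot)
open import Data.Fin.Patterns using (0F; 1F; 2F; 3F)
open import Data.Fin.Properties using (all?; any?; combine-remQuot; remQuot-combine; combine-injective; combine-injectiveˡ) renaming (_≟_ to _≟ᶠ_)
open import Data.Vec using (Vec; []; _∷_; lookup; updateAt; insertAt; removeAt; tabulate; replicate)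
open import Data.Vec.Properties using (lookup∘updateAt; lookup∘updateAt′; lookup∘tabulate; insertAt-removeAt)
open import Data.Vec.Relation.Binary.Pointwise.Extensional using (ext; Pointwise-≡⇒≡)
open import Data.Maybe using (Maybe; just; nothing)
open import Data.Maybe.Properties using (just-injective)
open import Data.List using (List; []; _∷_; map; allFin)
open import Data.List.Membership.Propositional using (_∈_)
open import Data.List.Membership.Propositional.Properties using (∈-map⁺; ∈-allFin)
open import Data.List.Relation.Unary.Any using (here; there)
open import Data.List.Relation.Unary.All as All using ()
open import Data.List.Relation.Unary.All.Properties using (all⁺)
open import Data.Product using (∃; _×_; _,_; proj₁; proj₂; uncurry)
open import Function using (_∘_; _∘₂_; id)
open import Function.Bundles using (Equivalence)
open import Function.Definitions using (Injective)
open import Relation.Nullary using (Dec; yes; no; contradiction)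
open import Relation.Nullary.Decidable using (map′; _×-dec_; _→-dec_; ¬?; toWitness; from-yes; isYes; does)
open import Relation.Unary using (Decidable)
open import Relation.Binary.PropositionalEquality using (_≡_; _≢_; refl; sym; trans; cong; cong₂; subst; module ≡-Reasoning)

MatchingColoringsAvoidable : ℕ → Set
MatchingColoringsAvoidable d =
  (φ : PartialColoring d) → ColoredEdgesFormMatching φ → IsAvoidable φ

lookup-flipAt : ∀ {d} (v : Vertex d) i → lookup (flipAt v i) i ≡ not (lookup v i)
lookup-flipAt v i = lookup∘updateAt i v

lookup-flipAt-≢ : ∀ {d} (v : Vertex d) {i j} → j ≢ i → lookup (flipAt v i) j ≡ lookup v j
lookup-flipAt-≢ v {i} {j} j≢i = lookup∘updateAt′ j i j≢i v

removeAt-updateAt : ∀ {n} {A : Set} (xs : Vec A (suc n)) i (f : A → A) →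
                    removeAt (updateAt xs i f) i ≡ removeAt xs i
removeAt-updateAt (x ∷ xs)     zero    f = refl
removeAt-updateAt (x ∷ y ∷ xs) (suc zero)    f = refl
removeAt-updateAt (x ∷ y ∷ xs) (suc (suc i)) f = cong (x ∷_) (removeAt-updateAt (y ∷ xs) (suc i) f)

label-insertAt-removeAt : ∀ {n} {A : Set} {g : Vertex (suc n) → Fin (suc n) → A} →
  IsEdgeLabelling g → ∀ v i b → g (insertAt (removeAt v i) i b) i ≡ g v i
label-insertAt-removeAt {g = g} lab v i b with b ≟ᵇ lookup v i
... | yes refl = cong (λ u → g u i) (insertAt-removeAt v i)
... | no b≢vᵢ = trans (cong (λ u → g u i) insert≡flip) (lab v i)
  where
  open ≡-Reasoning
  insert≡flip : insertAt (removeAt v i) i b ≡ flipAt v i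
  insert≡flip = begin
    insertAt (removeAt v i) i b
      ≡⟨ cong₂ (λ u c → insertAt u i c) (sym (removeAt-updateAt v i not))
               (trans (¬-not b≢vᵢ) (sym (lookup-flipAt v i))) ⟩
    insertAt (removeAt (flipAt v i) i) i (lookup (flipAt v i) i)
      ≡⟨ insertAt-removeAt (flipAt v i) i ⟩
    flipAt v i ∎

module _ {d} (φ ψ : PartialColoring d) (φ≗ψ : ∀ v i → proj₁ φ v i ≡ proj₁ ψ v i) where

  coloredEdgesFormMatching-resp : ColoredEdgesFormMatching ψ → ColoredEdgesFormMatching φ
  coloredEdgesFormMatching-resp matching v i j a b eᵢ eⱼ =
    matching v i j a b (trans (sym (φ≗ψ v i)) eᵢ) (trans (sym (φ≗ψ v j)) eⱼ)

  isAvoidable-resp : IsAvoidable ψ → IsAvoidable φ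
  isAvoidable-resp (F , proper , avoids) =
    F , proper , λ v i c e → avoids v i c (trans (sym (φ≗ψ v i)) e)

∀-combine : ∀ {m k} {P : Fin (m * k) → Set} → (∀ a b → P (combine a b)) → ∀ j → P j
∀-combine {m} {k} {P} p j = subst P (combine-remQuot {m} k j) (uncurry p (remQuot {m} k j))

-- Both coordinates and colours combine a b : Fin (m * k) are read as entry a of block b.
module Blocks (m k : ℕ) where

  ≡-blockwise : {u w : Vertex (m * k)} →
                (∀ a b → lookup u (combine a b) ≡ lookup w (combine a b)) → u ≡ w
  ≡-blockwise h = Pointwise-≡⇒≡ (ext (∀-combine {m} {k} h))

  block : Fin k → Vertex (m * k) → Vertex m
  block b v = tabulate λ a → lookup v (combine a b)

  overwriteIn : Fin k → Vertex m → Fin m × Fin k → Bool → Bool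
  overwriteIn b x (a , b′) old = if does (b′ ≟ᶠ b) then lookup x a else old

  setBlock : Fin k → Vertex m → Vertex (m * k) → Vertex (m * k)
  setBlock b x v = tabulate λ j → overwriteIn b x (remQuot {m} k j) (lookup v j)

  lookup-setBlock : ∀ b x v a b′ →
    lookup (setBlock b x v) (combine a b′) ≡ overwriteIn b x (a , b′) (lookup v (combine a b′))
  lookup-setBlock b x v a b′ =
    trans (lookup∘tabulate (λ j → overwriteIn b x (remQuot {m} k j) (lookup v j)) (combine a b′))
          (cong (λ r → overwriteIn b x r (lookup v (combine a b′))) (remQuot-combine a b′))

  lookup-setBlock-here : ∀ b x v a → lookup (setBlock b x v) (combine a b) ≡ lookup x a
  lookup-setBlock-here b x v a with b ≟ᶠ b | lookup-setBlock b x v a b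
  ... | yes _   | eq = eq
  ... | no b≢b  | _  = contradiction refl b≢b

  lookup-setBlock-there : ∀ {b b′} x v a → b′ ≢ b →
    lookup (setBlock b x v) (combine a b′) ≡ lookup v (combine a b′)
  lookup-setBlock-there {b} {b′} x v a b′≢b with b′ ≟ᶠ b | lookup-setBlock b x v a b′
  ... | yes b′≡b | _  = contradiction b′≡b b′≢b
  ... | no _     | eq = eq

  block-setBlock : ∀ b x v → block b (setBlock b x v) ≡ x
  block-setBlock b x v = Pointwise-≡⇒≡ (ext λ a →
    trans (lookup∘tabulate (λ a → lookup (setBlock b x v) (combine a b)) a) (lookup-setBlock-here b x v a))

  setBlock-block : ∀ b v → setBlock b (block b v) v ≡ v
  setBlock-block b v = ≡-blockwise at
    where
    at : ∀ a b′ → lookup (setBlock b (block b v) v) (combine a b′) ≡ lookup v (combine a b′)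
    at a b′ with b′ ≟ᶠ b
    ... | yes refl = trans (lookup-setBlock-here b (block b v) v a) (lookup∘tabulate (λ a → lookup v (combine a b)) a)
    ... | no b′≢b  = lookup-setBlock-there (block b v) v a b′≢b

  setBlock-setBlock : ∀ b x y v → setBlock b x (setBlock b y v) ≡ setBlock b x v
  setBlock-setBlock b x y v = ≡-blockwise at
    where
    at : ∀ a b′ → lookup (setBlock b x (setBlock b y v)) (combine a b′) ≡
                  lookup (setBlock b x v) (combine a b′)
    at a b′ with b′ ≟ᶠ b
    ... | yes refl = trans (lookup-setBlock-here b x (setBlock b y v) a) (sym (lookup-setBlock-here b x v a))
    ... | no b′≢b  = trans (lookup-setBlock-there x (setBlock b y v) a b′≢b)
                      (trans (lookup-setBlock-there y v a b′≢b) (sym (lookup-setBlock-there x v a b′≢b)))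

  setBlock-flipAt : ∀ b x v a → setBlock b (flipAt x a) v ≡ flipAt (setBlock b x v) (combine a b)
  setBlock-flipAt b x v a = ≡-blockwise at
    where
    at : ∀ a′ b′ → lookup (setBlock b (flipAt x a) v) (combine a′ b′) ≡
                   lookup (flipAt (setBlock b x v) (combine a b)) (combine a′ b′)
    at a′ b′ with b′ ≟ᶠ b
    at a′ b′ | no b′≢b = trans (lookup-setBlock-there (flipAt x a) v a′ b′≢b) (sym (trans
      (lookup-flipAt-≢ (setBlock b x v) (b′≢b ∘ proj₂ ∘ combine-injective a′ b′ a b))
      (lookup-setBlock-there x v a′ b′≢b)))
    at a′ b′ | yes refl with a′ ≟ᶠ a
    ... | yes refl = trans (lookup-setBlock-here b (flipAt x a) v a) (trans (lookup-flipAt x a)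
                      (sym (trans (lookup-flipAt (setBlock b x v) (combine a b))
                                  (cong not (lookup-setBlock-here b x v a)))))
    ... | no a′≢a  = trans (lookup-setBlock-here b (flipAt x a) v a′) (trans (lookup-flipAt-≢ x a′≢a)
                      (sym (trans (lookup-flipAt-≢ (setBlock b x v) (a′≢a ∘ combine-injectiveˡ a′ b a b))
                                  (lookup-setBlock-here b x v a′))))

  clearBlock : Fin k → Vertex (m * k) → Vertex (m * k)
  clearBlock b = setBlock b (replicate m false)

  flipAt-setBlock : ∀ b v a → flipAt v (combine a b) ≡ setBlock b (flipAt (block b v) a) v
  flipAt-setBlock b v a = begin
    flipAt v (combine a b)                           ≡⟨ cong (λ u → flipAt u (combine a b)) (sym (setBlock-block b v)) ⟩
    flipAt (setBlock b (block b v) v) (combine a b)  ≡⟨ sym (setBlock-flipAt b (block b v) v a) ⟩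
    setBlock b (flipAt (block b v) a) v              ∎
    where open ≡-Reasoning

  clearBlock-flipAt : ∀ b v a → clearBlock b (flipAt v (combine a b)) ≡ clearBlock b v
  clearBlock-flipAt b v a = trans (cong (clearBlock b) (flipAt-setBlock b v a))
                                  (setBlock-setBlock b (replicate m false) (flipAt (block b v) a) v)

  block-flipAt : ∀ b v a → block b (flipAt v (combine a b)) ≡ flipAt (block b v) a
  block-flipAt b v a = trans (cong (block b) (flipAt-setBlock b v a))
                             (block-setBlock b (flipAt (block b v) a) v)

  setBlock-clearBlock : ∀ b v → setBlock b (block b v) (clearBlock b v) ≡ v
  setBlock-clearBlock b v = trans (setBlock-setBlock b (block b v) (replicate m false) v) (setBlock-block b v)

  inBlock : Fin k → Fin m × Fin k → Maybe (Fin m)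
  inBlock b (c , b′) = if does (b′ ≟ᶠ b) then just c else nothing

  blockColor : Fin k → Maybe (Fin (m * k)) → Maybe (Fin m)
  blockColor b nothing  = nothing
  blockColor b (just c) = inBlock b (remQuot k c)

  blockColor-combine : ∀ b c → blockColor b (just (combine c b)) ≡ just c
  blockColor-combine b c = trans (cong (inBlock b) (remQuot-combine c b)) inBlock-here
    where
    inBlock-here : inBlock b (c , b) ≡ just c
    inBlock-here with b ≟ᶠ b
    ... | yes _   = refl
    ... | no b≢b = contradiction refl b≢b

  blockColor-just : ∀ b x {c} → blockColor b x ≡ just c → x ≡ just (combine c b)
  blockColor-just b (just c′) eq =
    cong just (trans (sym (combine-remQuot {m} k c′)) (inBlock-just (remQuot k c′) eq))
    where
    inBlock-just : ∀ {c} r → inBlock b r ≡ just c → uncurry combine r ≡ combine c b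
    inBlock-just (a , b′) eq with b′ ≟ᶠ b
    inBlock-just (a , b′) refl | yes refl = refl
    inBlock-just (a , b′) ()   | no _

  localColoring : PartialColoring (m * k) → Fin k → Vertex (m * k) → PartialColoring m
  localColoring (φ , φ-label) b w = ψ , ψ-label
    where
    ψ : Vertex m → Fin m → Maybe (Fin m)
    ψ x a = blockColor b (φ (setBlock b x w) (combine a b))
    ψ-label : IsEdgeLabelling ψ
    ψ-label x a = trans (cong (λ u → blockColor b (φ u (combine a b))) (setBlock-flipAt b x w a))
                        (cong (blockColor b) (φ-label (setBlock b x w) (combine a b)))

  localColoring-matching : ∀ φ → ColoredEdgesFormMatching φ → ∀ b w →
                           ColoredEdgesFormMatching (localColoring φ b w)
  localColoring-matching φ matching b w x a a′ c c′ e e′ =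
    combine-injectiveˡ a b a′ b (matching (setBlock b x w) (combine a b) (combine a′ b) _ _
                                          (blockColor-just b _ e) (blockColor-just b _ e′))

module Glue {m k : ℕ} (avoidable-m : MatchingColoringsAvoidable m)
         (φ : PartialColoring (m * k)) (matching : ColoredEdgesFormMatching φ) where

  open Blocks m k

  private
    local : ∀ b w → IsAvoidable (localColoring φ b w)
    local b w = avoidable-m (localColoring φ b w) (localColoring-matching φ matching b w)

    g : Fin k → Vertex (m * k) → Vertex m → Fin m → Fin m
    g b w = proj₁ (proj₁ (local b w))

  -- The local colouring is selected by clearBlock b v, which is constant along the edges of
  -- block b; this is what makes glued an edge labelling.
  gluedAt : Vertex (m * k) → Fin m × Fin k → Fin (m * k)
  gluedAt v (a , b) = combine (g b (clearBlock b v) (block b v) a) b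

  glued : Vertex (m * k) → Fin (m * k) → Fin (m * k)
  glued v j = gluedAt v (remQuot {m} k j)

  glued-combine : ∀ v a b → glued v (combine a b) ≡ gluedAt v (a , b)
  glued-combine v a b = cong (gluedAt v) (remQuot-combine a b)

  glued-isEdgeLabelling : IsEdgeLabelling glued
  glued-isEdgeLabelling v = ∀-combine {m} {k} λ a b → begin
    glued (flipAt v (combine a b)) (combine a b)
      ≡⟨ glued-combine (flipAt v (combine a b)) a b ⟩
    combine (g b (clearBlock b (flipAt v (combine a b))) (block b (flipAt v (combine a b))) a) b
      ≡⟨ cong₂ (λ w x → combine (g b w x a) b) (clearBlock-flipAt b v a) (block-flipAt b v a) ⟩
    combine (g b (clearBlock b v) (flipAt (block b v) a) a) b
      ≡⟨ cong (λ c → combine c b) (proj₂ (proj₁ (local b (clearBlock b v))) (block b v) a) ⟩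
    gluedAt v (a , b)
      ≡⟨ sym (glued-combine v a b) ⟩
    glued v (combine a b) ∎
    where open ≡-Reasoning

  glued-injective : ∀ v → Injective _≡_ _≡_ (glued v)
  glued-injective v {j} {j′} =
    ∀-combine {m} {k} {λ j → glued v j ≡ glued v j′ → j ≡ j′} (λ a b →
      ∀-combine {m} {k} {λ j′ → glued v (combine a b) ≡ glued v j′ → combine a b ≡ j′}
                (injective-at a b) j′) j
    where
    injective-at : ∀ a b a′ b′ → glued v (combine a b) ≡ glued v (combine a′ b′) →
                   combine a b ≡ combine a′ b′
    injective-at a b a′ b′ eq
      with combine-injective _ b _ b′ (trans (sym (glued-combine v a b)) (trans eq (glued-combine v a′ b′)))
    ... | gₐ≡gₐ′ , refl =
      cong (λ a → combine a b) (proj₁ (proj₂ (local b (clearBlock b v))) (block b v) gₐ≡gₐ′)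

  glued-avoids : ∀ v j c → proj₁ φ v j ≡ just c → glued v j ≢ c
  glued-avoids v = ∀-combine {m} {k} {λ j → ∀ c → proj₁ φ v j ≡ just c → glued v j ≢ c} avoids-at
    where
    avoids-at : ∀ a b c → proj₁ φ v (combine a b) ≡ just c → glued v (combine a b) ≢ c
    avoids-at a b c φ≡c glued≡c =
      proj₂ (proj₂ (local b (clearBlock b v))) (block b v) a gluedColor local≡ refl
      where
      open ≡-Reasoning
      gluedColor : Fin m
      gluedColor = g b (clearBlock b v) (block b v) a
      local≡ : proj₁ (localColoring φ b (clearBlock b v)) (block b v) a ≡ just gluedColor
      local≡ = begin
        blockColor b (proj₁ φ (setBlock b (block b v) (clearBlock b v)) (combine a b))
          ≡⟨ cong (λ u → blockColor b (proj₁ φ u (combine a b))) (setBlock-clearBlock b v) ⟩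
        blockColor b (proj₁ φ v (combine a b))
          ≡⟨ cong (blockColor b) (trans φ≡c (cong just (trans (sym glued≡c) (glued-combine v a b)))) ⟩
        blockColor b (just (combine gluedColor b))
          ≡⟨ blockColor-combine b gluedColor ⟩
        just gluedColor ∎

matchingColoringsAvoidable-* : ∀ {m} k → MatchingColoringsAvoidable m → MatchingColoringsAvoidable (m * k)
matchingColoringsAvoidable-* k avoidable-m φ matching =
  (glued , glued-isEdgeLabelling) , glued-injective , glued-avoids
  where open Glue {k = k} avoidable-m φ matching

∀-vertex? : ∀ {d} {P : Vertex d → Set} → Decidable P → Dec (∀ v → P v)
∀-vertex? {zero}  P? = map′ (λ p → λ { [] → p }) (λ p → p []) (P? [])
∀-vertex? {suc d} P? =
  map′ (λ (p₀ , p₁) → λ { (false ∷ v) → p₀ v ; (true ∷ v) → p₁ v })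
       (λ p → (λ v → p (false ∷ v)) , (λ v → p (true ∷ v)))
       (∀-vertex? (λ v → P? (false ∷ v)) ×-dec ∀-vertex? (λ v → P? (true ∷ v)))

coloredEdgesFormMatching? : ∀ {d} (φ : PartialColoring d) → Dec (ColoredEdgesFormMatching φ)
coloredEdgesFormMatching? {d} (φ , _) =
  ∀-vertex? λ v → map′ (λ p i j a b eᵢ → p i a eᵢ j b) (λ p i a eᵢ j b → p i j a b eᵢ)
                       (all? λ i → onlyColored? v i (φ v i))
  where
  sameOrUncolored? : (i j : Fin d) (y : Maybe (Fin d)) → Dec (∀ b → y ≡ just b → i ≡ j)
  sameOrUncolored? i j nothing  = yes λ _ ()
  sameOrUncolored? i j (just b) = map′ (λ i≡j _ _ → i≡j) (λ p → p b refl) (i ≟ᶠ j)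

  onlyColored? : ∀ v i (x : Maybe (Fin d)) →
                 Dec (∀ a → x ≡ just a → ∀ j b → φ v j ≡ just b → i ≡ j)
  onlyColored? v i nothing  = yes λ _ ()
  onlyColored? v i (just a) = map′ (λ p _ _ → p) (λ p → p a refl)
                                   (all? λ j → sameOrUncolored? i j (φ v j))

Avoids : ∀ {d} → (Vertex d → Fin d → Fin d) → PartialColoring d → Set
Avoids {d} f (φ , _) = ∀ (v : Vertex d) (i c : Fin d) → φ v i ≡ just c → f v i ≢ c

avoids? : ∀ {d} (f : Vertex d → Fin d → Fin d) (φ : PartialColoring d) → Dec (Avoids f φ)
avoids? {d} f (φ , _) = ∀-vertex? λ v → all? λ i → differs? (φ v i) (f v i)
  where
  differs? : (x : Maybe (Fin d)) (y : Fin d) → Dec (∀ c → x ≡ just c → y ≢ c)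
  differs? nothing  y = yes λ _ ()
  differs? (just c) y =
    map′ (λ y≢c c′ eq → subst (y ≢_) (just-injective eq) y≢c) (λ p → p c refl)
         (¬? (y ≟ᶠ c))

layered : ∀ {d} → Fin d → (σ τ : Fin d → Fin d) → Vertex d → Fin d → Fin d
layered t σ τ v = if lookup v t then τ else σ

module _ {d} {t : Fin d} {σ τ : Fin d → Fin d} where

  layered-isEdgeLabelling : σ t ≡ τ t → IsEdgeLabelling (layered t σ τ)
  layered-isEdgeLabelling σt≡τt v i with i ≟ᶠ t
  ... | yes refl = trans (cong (λ b → (if b then τ else σ) i) (lookup-flipAt v i)) (swap-layer (lookup v i))
    where
    swap-layer : ∀ b → (if not b then τ else σ) i ≡ (if b then τ else σ) i
    swap-layer true  = σt≡τt
    swap-layer false = sym σt≡τt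
  ... | no i≢t = cong (λ b → (if b then τ else σ) i) (lookup-flipAt-≢ v (i≢t ∘ sym))

  layered-injective : Injective _≡_ _≡_ σ → Injective _≡_ _≡_ τ →
                      ∀ v → Injective _≡_ _≡_ (layered t σ τ v)
  layered-injective σ-inj τ-inj v with lookup v t
  ... | true  = τ-inj
  ... | false = σ-inj

  layered-avoidable : (φ : PartialColoring d) → Injective _≡_ _≡_ σ → Injective _≡_ _≡_ τ →
                      σ t ≡ τ t → Avoids (layered t σ τ) φ → IsAvoidable φ
  layered-avoidable φ σ-inj τ-inj σt≡τt avoids =
    (layered t σ τ , layered-isEdgeLabelling σt≡τt) , layered-injective σ-inj τ-inj , avoids

_⊑_ : ∀ {A : Set} {n} → Vec (Maybe A) n → Vec (Maybe A) n → Set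
s ⊑ t = ∀ e {x} → lookup s e ≡ just x → lookup t e ≡ just x

∷-⊑ : ∀ {A : Set} {n} (x : Maybe A) {s t : Vec (Maybe A) n} → s ⊑ t → (x ∷ s) ⊑ (x ∷ t)
∷-⊑ x s⊑t zero    eq = eq
∷-⊑ x s⊑t (suc e) eq = s⊑t e eq

replicate-⊑ : ∀ {A : Set} {n} (t : Vec (Maybe A) n) → replicate n nothing ⊑ t
replicate-⊑ (_ ∷ _) zero    ()
replicate-⊑ (_ ∷ t) (suc e) eq = replicate-⊑ t e eq

module Backtracking {A : Set} (values : List (Maybe A)) (∈-values : ∀ x → x ∈ values)
  {n} {P Q : Vec (Maybe A) n → Set} (P? : Decidable P) (Q? : Decidable Q)
  (P-⊑ : ∀ {s t} → s ⊑ t → P t → P s) where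

  Monotone : ∀ {m} → (Vec (Maybe A) m → Vec (Maybe A) n) → Set
  Monotone fill = ∀ {s t} → s ⊑ t → fill s ⊑ fill t

  -- fill s is the table whose last m entries are s, the others having been chosen already.
  -- An entry x is kept only if P holds with the entries still open left uncoloured;
  -- since P is closed under ⊑, a failure rules out every completion.
  explore : ∀ m → (Vec (Maybe A) m → Vec (Maybe A) n) → Bool
  explore zero    fill = isYes (Q? (fill []))
  explore (suc m) fill = all next values
    where
    next : Maybe A → Bool
    next x = if isYes (P? (fill (x ∷ replicate m nothing))) then explore m (fill ∘ (x ∷_)) else true

  explore-sound : ∀ m fill → Monotone fill → T (explore m fill) → ∀ s → P (fill s) → Q (fill s)
  explore-sound zero    fill _    ok [] _ = toWitness ok
  explore-sound (suc m) fill mono ok (x ∷ s) p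
    with P? (fill (x ∷ replicate m nothing)) | All.lookup (all⁺ _ values ok) (∈-values x)
  ... | yes _  | okₓ = explore-sound m (fill ∘ (x ∷_)) (λ s⊑t → mono (∷-⊑ x s⊑t)) okₓ s p
  ... | no ¬pₓ | _   = contradiction (P-⊑ (mono (∷-⊑ x (replicate-⊑ s))) p) ¬pₓ

  search-sound : explore n id ≡ true → ∀ t → P t → Q t
  search-sound ok = explore-sound n id id (Equivalence.from T-≡ ok)

Table : Set
Table = Vec (Maybe (Fin 3)) 12

colorValues : List (Maybe (Fin 3))
colorValues = nothing ∷ map just (allFin 3)

∈-colorValues : ∀ x → x ∈ colorValues
∈-colorValues nothing  = here refl
∈-colorValues (just c) = there (∈-map⁺ just (∈-allFin c))

vertexIndex : Vertex 2 → Fin 4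
vertexIndex (false ∷ false ∷ []) = 0F
vertexIndex (false ∷ true  ∷ []) = 1F
vertexIndex (true  ∷ false ∷ []) = 2F
vertexIndex (true  ∷ true  ∷ []) = 3F

indexVertex : Fin 4 → Vertex 2
indexVertex 0F = false ∷ false ∷ []
indexVertex 1F = false ∷ true  ∷ []
indexVertex 2F = true  ∷ false ∷ []
indexVertex 3F = true  ∷ true  ∷ []

indexVertex-vertexIndex : ∀ u → indexVertex (vertexIndex u) ≡ u
indexVertex-vertexIndex (false ∷ false ∷ []) = refl
indexVertex-vertexIndex (false ∷ true  ∷ []) = refl
indexVertex-vertexIndex (true  ∷ false ∷ []) = refl
indexVertex-vertexIndex (true  ∷ true  ∷ []) = refl

-- The edge in direction i through v is entry 4 i + u of a table, where u encodes the
-- two other coordinates of v in binary.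
edgeIndex : Vertex 3 → Fin 3 → Fin 12
edgeIndex v i = combine i (vertexIndex (removeAt v i))

coloringOf : Table → PartialColoring 3
coloringOf t = (λ v i → lookup t (edgeIndex v i)) ,
               (λ v i → cong (λ u → lookup t (combine i (vertexIndex u))) (removeAt-updateAt v i not))

colorOfEdgeIndex : PartialColoring 3 → Fin 3 → Fin 4 → Maybe (Fin 3)
colorOfEdgeIndex (ψ , _) i u = ψ (insertAt (indexVertex u) i false) i

tableOf : PartialColoring 3 → Table
tableOf φ = tabulate (uncurry (colorOfEdgeIndex φ) ∘ remQuot 4)

coloringOf-tableOf : ∀ φ v i → proj₁ (coloringOf (tableOf φ)) v i ≡ proj₁ φ v i
coloringOf-tableOf φ@(ψ , lab) v i = begin
  lookup (tableOf φ) (edgeIndex v i)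
    ≡⟨ lookup∘tabulate (uncurry (colorOfEdgeIndex φ) ∘ remQuot 4) (edgeIndex v i) ⟩
  uncurry (colorOfEdgeIndex φ) (remQuot 4 (combine i (vertexIndex (removeAt v i))))
    ≡⟨ cong (uncurry (colorOfEdgeIndex φ)) (remQuot-combine i _) ⟩
  ψ (insertAt (indexVertex (vertexIndex (removeAt v i))) i false) i
    ≡⟨ cong (λ u → ψ (insertAt u i false) i) (indexVertex-vertexIndex (removeAt v i)) ⟩
  ψ (insertAt (removeAt v i) i false) i
    ≡⟨ label-insertAt-removeAt lab v i false ⟩
  ψ v i ∎
  where open ≡-Reasoning

permutation : Fin 6 → Fin 3 → Fin 3
permutation = lookup ∘ lookup permutations
  where
  permutations : Vec (Vec (Fin 3) 3) 6
  permutations = (0F ∷ 1F ∷ 2F ∷ []) ∷ (0F ∷ 2F ∷ 1F ∷ []) ∷ (1F ∷ 0F ∷ 2F ∷ []) ∷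
                 (1F ∷ 2F ∷ 0F ∷ []) ∷ (2F ∷ 0F ∷ 1F ∷ []) ∷ (2F ∷ 1F ∷ 0F ∷ []) ∷ []

permutation-injective : ∀ a → Injective _≡_ _≡_ (permutation a)
permutation-injective a {i} {j} = from-yes injective? a i j
  where
  injective? : Dec (∀ a i j → permutation a i ≡ permutation a j → i ≡ j)
  injective? = all? λ a → all? λ i → all? λ j → (permutation a i ≟ᶠ permutation a j) →-dec (i ≟ᶠ j)

MatchingTable : Table → Set
MatchingTable t = ColoredEdgesFormMatching (coloringOf t)

matchingTable-⊑ : ∀ {s t} → s ⊑ t → MatchingTable t → MatchingTable s
matchingTable-⊑ s⊑t matching v i j a b eᵢ eⱼ = matching v i j a b (s⊑t _ eᵢ) (s⊑t _ eⱼ)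

LayeredAvoidable : Table → Set
LayeredAvoidable t = ∃ λ s → ∃ λ a → ∃ λ b → permutation a s ≡ permutation b s ×
  Avoids (layered s (permutation a) (permutation b)) (coloringOf t)

layeredAvoidable? : Decidable LayeredAvoidable
layeredAvoidable? t = any? λ s → any? λ a → any? λ b →
  (permutation a s ≟ᶠ permutation b s) ×-dec avoids? (layered s (permutation a) (permutation b)) (coloringOf t)

layeredAvoidable⇒isAvoidable : ∀ t → LayeredAvoidable t → IsAvoidable (coloringOf t)
layeredAvoidable⇒isAvoidable t (s , a , b , σs≡τs , avoids) =
  layered-avoidable (coloringOf t) (permutation-injective a) (permutation-injective b) σs≡τs avoids

module Q₃Search = Backtracking colorValues ∈-colorValues (coloredEdgesFormMatching? ∘ coloringOf)
                                layeredAvoidable? (λ {s t} → matchingTable-⊑ {s} {t})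

-- refl runs the search; it reaches 2332 tables, one for each matching colouring of Q₃.
matchingTable-layeredAvoidable : ∀ t → MatchingTable t → LayeredAvoidable t
matchingTable-layeredAvoidable = Q₃Search.search-sound refl

matchingColoringsAvoidable-3 : MatchingColoringsAvoidable 3
matchingColoringsAvoidable-3 φ matching =
  isAvoidable-resp φ (coloringOf (tableOf φ)) (sym ∘₂ coloringOf-tableOf φ)
    (layeredAvoidable⇒isAvoidable (tableOf φ) (matchingTable-layeredAvoidable (tableOf φ)
      (coloredEdgesFormMatching-resp (coloringOf (tableOf φ)) φ (coloringOf-tableOf φ) matching)))

corollary4p5 : (k : ℕ) → 0 < k → (φ : PartialColoring (3 * k)) →
    ColoredEdgesFormMatching φ → IsAvoidable φ
corollary4p5 k _ = matchingColoringsAvoidable-* k matchingColoringsAvoidable-3
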